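{- Let $n\ge 2$. The path $P_n$ on $n$ vertices has a unique maximum open packing if and only if $n\equiv 2\pmod 4$.
   Context: An open packing in a graph is a set of vertices whose open neighborhoods are pairwise disjoint; a maximum open packing is one of maximum cardinality. -}

module Defs where

open import Data.Nat using (ℕ; suc; _≤_)
open import Data.Fin using (Fin; toℕ)
open import Data.Fin.Subset using (Subset; _∈_; ∣_∣)
open import Data.Sum using (_⊎_)
open import Data.Product using (_×_; Σ)
open import Relation.Binary.PropositionalEquality using (_≡_; _≢_)
open import Relation.Nullary using (¬_)

PathAdj : ∀ {n} → Fin n → Fin n → Set
PathAdj i j = (suc (toℕ i) ≡ toℕ j) ⊎ (suc (toℕ j) ≡ toℕ i)

-- Open packing of P_n: distinct vertices of S have disjoint open
-- neighbourhoods, i.e. no vertex w is adjacent to two distinct members of S.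
IsOpenPacking : ∀ n → Subset n → Set
IsOpenPacking n S =
  ∀ (u v w : Fin n) → u ∈ S → v ∈ S → u ≢ v →
    ¬ (PathAdj u w × PathAdj v w)

IsMaxOpenPacking : ∀ n → Subset n → Set
IsMaxOpenPacking n S =
  IsOpenPacking n S × (∀ (T : Subset n) → IsOpenPacking n T → ∣ T ∣ ≤ ∣ S ∣)

HasUniqueMaxOpenPacking : ℕ → Set
HasUniqueMaxOpenPacking n =
  Σ (Subset n) λ S → IsMaxOpenPacking n S ×
    (∀ (T : Subset n) → IsMaxOpenPacking n T → T ≡ S)

module Submission where

-- In P_n two vertices share a neighbour exactly when they are at distance
-- two, so an open packing is a set of vertices containing no two members
-- at distance two (NoDistanceTwo).  Cutting a vertex set into consecutive
-- blocks of four, each block contributes at most two members, which gives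
-- the bound ∣ S ∣ ≤ packingNumber n = 2⌊n/4⌋ + min(n mod 4, 2).
-- The periodic pattern 1100 1100 … (blocks n) attains it, hence it is the
-- open packing number.  If n ≢ 2 (mod 4) the pattern can be shifted at the
-- end (shiftedBlocks n, e.g. 0011 versus 1100 for n = 4), giving a second
-- maximum packing.  If n ≡ 2 (mod 4) an induction on the blocks shows that a
-- maximum packing must coincide with the pattern: the tail is forced by
-- induction, it starts with two members, which empties the last two places
-- of the first block, and the first two places must then be full.

open import Defs
open import Data.Nat using (ℕ; _≤_; _%_)
open import Function.Bundles using (_⇔_)
open import Relation.Binary.PropositionalEquality using (_≡_)

open import Data.Nat using (zero; suc; _+_; z≤n; s≤s; _≟_)
open import Data.Nat.Properties
  using (≤-trans; ≤-refl; ≤-antisym; n≤1+n; m≤n+m; 1+n≰n; suc-injective; +-cancelˡ-≤)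
open import Data.Bool using (_∧_)
open import Data.Bool.Properties using (∧-identityʳ)
open import Data.Vec using ([]; _∷_; _[_]=_; here; there)
open import Data.Vec.Properties using (∷-injectiveʳ)
open import Data.Fin using (Fin; toℕ; zero; suc)
open import Data.Fin.Properties using (toℕ-injective)
import Data.Fin.Properties as Fin
open import Data.Fin.Subset using (Subset; ∣_∣; inside; outside)
open import Data.Fin.Subset.Properties using (∣p∣≤n; ∣p∣≡n⇒p≡⊤)
open import Data.Unit using (⊤; tt)
open import Data.Empty using (⊥; ⊥-elim)
open import Data.Sum using (inj₁; inj₂)
open import Data.Product using (_×_; _,_; proj₁)
open import Relation.Nullary using (yes; no)
open import Relation.Binary.PropositionalEquality using (_≢_; refl; sym; trans; cong; subst)
open import Function.Bundles using (mk⇔)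

NoDistanceTwo : ∀ {n} → Subset n → Set
NoDistanceTwo (x ∷ y ∷ z ∷ S) = (x ∧ z ≡ outside) × NoDistanceTwo (y ∷ z ∷ S)
NoDistanceTwo _ = ⊤

noDistanceTwo-tail : ∀ {n} x (S : Subset n) → NoDistanceTwo (x ∷ S) → NoDistanceTwo S
noDistanceTwo-tail x [] _ = tt
noDistanceTwo-tail x (y ∷ []) _ = tt
noDistanceTwo-tail x (y ∷ z ∷ S) (_ , ok) = ok

noDistanceTwo-afterBlock : ∀ {n} a b c d (S : Subset n) →
                           NoDistanceTwo (a ∷ b ∷ c ∷ d ∷ S) → NoDistanceTwo S
noDistanceTwo-afterBlock a b c d S (_ , _ , ok) =
  noDistanceTwo-tail d S (noDistanceTwo-tail c (d ∷ S) ok)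

noDistanceTwo-outside∷ : ∀ {n} (S : Subset n) → NoDistanceTwo S → NoDistanceTwo (outside ∷ S)
noDistanceTwo-outside∷ [] _ = tt
noDistanceTwo-outside∷ (x ∷ []) _ = tt
noDistanceTwo-outside∷ (x ∷ y ∷ S) ok = refl , ok

noDistanceTwo-block∷ : ∀ {n} (S : Subset n) → NoDistanceTwo S →
                       NoDistanceTwo (inside ∷ inside ∷ outside ∷ outside ∷ S)
noDistanceTwo-block∷ S ok =
  refl , refl , noDistanceTwo-outside∷ (outside ∷ S) (noDistanceTwo-outside∷ S ok)

noMembersAtDistanceTwo : ∀ {n} (S : Subset n) → NoDistanceTwo S → ∀ {i j : Fin n} →
  S [ i ]= inside → S [ j ]= inside → toℕ j ≡ suc (suc (toℕ i)) → ⊥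
noMembersAtDistanceTwo (x ∷ y ∷ z ∷ S) (() , _) here (there (there here)) _
noMembersAtDistanceTwo (x ∷ S) _ here here ()
noMembersAtDistanceTwo (x ∷ S) _ here (there here) ()
noMembersAtDistanceTwo (x ∷ y ∷ z ∷ S) _ here (there (there (there _))) ()
noMembersAtDistanceTwo (x ∷ S) _ (there _) here ()
noMembersAtDistanceTwo (x ∷ S) ok (there i∈S) (there j∈S) j≡i+2 =
  noMembersAtDistanceTwo S (noDistanceTwo-tail x S ok) i∈S j∈S (suc-injective j≡i+2)

-- Two distinct common neighbours of w lie on opposite sides of w, i.e. at
-- distance two; two neighbours on the same side coincide.
noDistanceTwo⇒openPacking : ∀ {n} (S : Subset n) → NoDistanceTwo S → IsOpenPacking n S
noDistanceTwo⇒openPacking S ok u v w u∈S v∈S u≢v adjacent with adjacent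
... | inj₁ u+1≡w , inj₁ v+1≡w = u≢v (toℕ-injective (suc-injective (trans u+1≡w (sym v+1≡w))))
... | inj₂ w+1≡u , inj₂ w+1≡v = u≢v (toℕ-injective (trans (sym w+1≡u) w+1≡v))
... | inj₁ u+1≡w , inj₂ w+1≡v =
  noMembersAtDistanceTwo S ok u∈S v∈S (trans (sym w+1≡v) (cong suc (sym u+1≡w)))
... | inj₂ w+1≡u , inj₁ v+1≡w =
  noMembersAtDistanceTwo S ok v∈S u∈S (trans (sym w+1≡u) (cong suc (sym v+1≡w)))

-- Deleting the first vertex of P_{n+1} leaves a copy of P_n, so open packings
-- restrict to the tail.
openPacking-tail : ∀ {n} x (S : Subset n) → IsOpenPacking (suc n) (x ∷ S) → IsOpenPacking n S
openPacking-tail x S packing u v w u∈S v∈S u≢v (u~w , v~w) =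
  packing (suc u) (suc v) (suc w) (there u∈S) (there v∈S) (λ e → u≢v (Fin.suc-injective e))
    (shift u~w , shift v~w)
  where
  shift : ∀ {n} {p q : Fin n} → PathAdj p q → PathAdj {suc n} (suc p) (suc q)
  shift (inj₁ e) = inj₁ (cong suc e)
  shift (inj₂ e) = inj₂ (cong suc e)

-- Conversely, vertices 0 and 2 share the neighbour 1, so an open packing
-- contains at most one of them; the rest follows on the tail.
openPacking⇒noDistanceTwo : ∀ {n} (S : Subset n) → IsOpenPacking n S → NoDistanceTwo S
openPacking⇒noDistanceTwo [] _ = tt
openPacking⇒noDistanceTwo (x ∷ []) _ = tt
openPacking⇒noDistanceTwo (x ∷ y ∷ []) _ = tt
openPacking⇒noDistanceTwo (x ∷ y ∷ z ∷ S) packing =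
  ends x z packing , openPacking⇒noDistanceTwo (y ∷ z ∷ S) (openPacking-tail x _ packing)
  where
  ends : ∀ x z → IsOpenPacking _ (x ∷ y ∷ z ∷ S) → x ∧ z ≡ outside
  ends outside z _ = refl
  ends inside outside _ = refl
  ends inside inside packing = ⊥-elim
    (packing zero (suc (suc zero)) (suc zero) here (there (there here)) (λ ())
      (inj₁ refl , inj₂ refl))

-- 2⌊n/4⌋ + min(n mod 4, 2): the bound below, attained by blocks n, so it is
-- the open packing number of P_n.
packingNumber : ℕ → ℕ
packingNumber 0 = 0
packingNumber 1 = 1
packingNumber 2 = 2
packingNumber 3 = 2
packingNumber (suc (suc (suc (suc n)))) = suc (suc (packingNumber n))

-- A block of four consecutive vertices holds at most two members, since
-- positions 1,3 and positions 2,4 are each at distance two.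
blockBound : ∀ {k} a b c d (S : Subset k) → a ∧ c ≡ outside → b ∧ d ≡ outside →
             ∣ a ∷ b ∷ c ∷ d ∷ S ∣ ≤ 2 + ∣ S ∣
blockBound inside inside outside outside S _ _ = ≤-refl
blockBound inside outside outside inside S _ _ = ≤-refl
blockBound outside inside inside outside S _ _ = ≤-refl
blockBound outside outside inside inside S _ _ = ≤-refl
blockBound inside outside outside outside S _ _ = n≤1+n _
blockBound outside inside outside outside S _ _ = n≤1+n _
blockBound outside outside inside outside S _ _ = n≤1+n _
blockBound outside outside outside inside S _ _ = n≤1+n _
blockBound outside outside outside outside S _ _ = m≤n+m _ 2
blockBound inside _ inside _ S () _
blockBound outside inside outside inside S _ ()

tripleBound : ∀ a b c → a ∧ c ≡ outside → ∣ a ∷ b ∷ c ∷ [] ∣ ≤ 2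
tripleBound inside inside outside _ = ≤-refl
tripleBound inside outside outside _ = n≤1+n _
tripleBound outside inside inside _ = ≤-refl
tripleBound outside inside outside _ = n≤1+n _
tripleBound outside outside inside _ = n≤1+n _
tripleBound outside outside outside _ = z≤n
tripleBound inside _ inside ()

sizeBound : ∀ {n} (S : Subset n) → NoDistanceTwo S → ∣ S ∣ ≤ packingNumber n
sizeBound [] _ = z≤n
sizeBound S@(_ ∷ []) _ = ∣p∣≤n S
sizeBound S@(_ ∷ _ ∷ []) _ = ∣p∣≤n S
sizeBound (a ∷ b ∷ c ∷ []) (a∧c , _) = tripleBound a b c a∧c
sizeBound (a ∷ b ∷ c ∷ d ∷ S) ok@(a∧c , b∧d , _) =
  ≤-trans (blockBound a b c d S a∧c b∧d)
    (s≤s (s≤s (sizeBound S (noDistanceTwo-afterBlock a b c d S ok))))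

blocks : (n : ℕ) → Subset n
blocks 0 = []
blocks 1 = inside ∷ []
blocks 2 = inside ∷ inside ∷ []
blocks 3 = inside ∷ inside ∷ outside ∷ []
blocks (suc (suc (suc (suc n)))) = inside ∷ inside ∷ outside ∷ outside ∷ blocks n

shiftedBlocks : (n : ℕ) → Subset n
shiftedBlocks 0 = []
shiftedBlocks 1 = inside ∷ []
shiftedBlocks 2 = inside ∷ inside ∷ []
shiftedBlocks 3 = outside ∷ inside ∷ inside ∷ []
shiftedBlocks 4 = outside ∷ outside ∷ inside ∷ inside ∷ []
shiftedBlocks 5 = inside ∷ outside ∷ outside ∷ inside ∷ inside ∷ []
shiftedBlocks (suc (suc (suc (suc n@(suc (suc _)))))) =
  inside ∷ inside ∷ outside ∷ outside ∷ shiftedBlocks n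

noDistanceTwo-blocks : ∀ n → NoDistanceTwo (blocks n)
noDistanceTwo-blocks 0 = tt
noDistanceTwo-blocks 1 = tt
noDistanceTwo-blocks 2 = tt
noDistanceTwo-blocks 3 = refl , tt
noDistanceTwo-blocks (suc (suc (suc (suc n)))) =
  noDistanceTwo-block∷ (blocks n) (noDistanceTwo-blocks n)

∣blocks∣ : ∀ n → ∣ blocks n ∣ ≡ packingNumber n
∣blocks∣ 0 = refl
∣blocks∣ 1 = refl
∣blocks∣ 2 = refl
∣blocks∣ 3 = refl
∣blocks∣ (suc (suc (suc (suc n)))) = cong (λ k → suc (suc k)) (∣blocks∣ n)

noDistanceTwo-shiftedBlocks : ∀ n → NoDistanceTwo (shiftedBlocks n)
noDistanceTwo-shiftedBlocks 0 = tt
noDistanceTwo-shiftedBlocks 1 = tt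
noDistanceTwo-shiftedBlocks 2 = tt
noDistanceTwo-shiftedBlocks 3 = refl , tt
noDistanceTwo-shiftedBlocks 4 = refl , refl , tt
noDistanceTwo-shiftedBlocks 5 = refl , refl , refl , tt
noDistanceTwo-shiftedBlocks (suc (suc (suc (suc n@(suc (suc _)))))) =
  noDistanceTwo-block∷ (shiftedBlocks n) (noDistanceTwo-shiftedBlocks n)

∣shiftedBlocks∣ : ∀ n → ∣ shiftedBlocks n ∣ ≡ packingNumber n
∣shiftedBlocks∣ 0 = refl
∣shiftedBlocks∣ 1 = refl
∣shiftedBlocks∣ 2 = refl
∣shiftedBlocks∣ 3 = refl
∣shiftedBlocks∣ 4 = refl
∣shiftedBlocks∣ 5 = refl
∣shiftedBlocks∣ (suc (suc (suc (suc n@(suc (suc _)))))) =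
  cong (λ k → suc (suc k)) (∣shiftedBlocks∣ n)

shiftedBlocks≢blocks : ∀ n → 2 ≤ n → n % 4 ≢ 2 → shiftedBlocks n ≢ blocks n
shiftedBlocks≢blocks 1 (s≤s ()) _ _
shiftedBlocks≢blocks 2 _ n≢2 _ = n≢2 refl
shiftedBlocks≢blocks 3 _ _ ()
shiftedBlocks≢blocks 4 _ _ ()
shiftedBlocks≢blocks 5 _ _ ()
shiftedBlocks≢blocks (suc (suc (suc (suc n@(suc (suc _)))))) _ n≢2 same =
  shiftedBlocks≢blocks n (s≤s (s≤s z≤n)) n≢2
    (∷-injectiveʳ (∷-injectiveʳ (∷-injectiveʳ (∷-injectiveʳ same))))

attainsBound⇒maximum : ∀ {n} (S : Subset n) → NoDistanceTwo S → ∣ S ∣ ≡ packingNumber n →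
                       IsMaxOpenPacking n S
attainsBound⇒maximum S ok ∣S∣≡ρ =
  noDistanceTwo⇒openPacking S ok ,
  λ T packing → subst (_ ≤_) (sym ∣S∣≡ρ) (sizeBound T (openPacking⇒noDistanceTwo T packing))

blocks-maximum : ∀ n → IsMaxOpenPacking n (blocks n)
blocks-maximum n = attainsBound⇒maximum (blocks n) (noDistanceTwo-blocks n) (∣blocks∣ n)

shiftedBlocks-maximum : ∀ n → IsMaxOpenPacking n (shiftedBlocks n)
shiftedBlocks-maximum n =
  attainsBound⇒maximum (shiftedBlocks n) (noDistanceTwo-shiftedBlocks n) (∣shiftedBlocks∣ n)

maximum⇒attainsBound : ∀ {n} (T : Subset n) → IsMaxOpenPacking n T → packingNumber n ≤ ∣ T ∣
maximum⇒attainsBound {n} T (_ , largest) =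
  subst (_≤ ∣ T ∣) (∣blocks∣ n) (largest (blocks n) (proj₁ (blocks-maximum n)))

-- When k ≡ 2 (mod 4) the pattern blocks k starts with two members, so the
-- two places before it must be empty.
clearedBeforeBlocks : ∀ {k} c d → k % 4 ≡ 2 → NoDistanceTwo (c ∷ d ∷ blocks k) →
                      (c ≡ outside) × (d ≡ outside)
clearedBeforeBlocks {0} c d () _
clearedBeforeBlocks {1} c d () _
clearedBeforeBlocks {3} c d () _
clearedBeforeBlocks {2} c d _ (c∧1 , d∧1 , _) =
  trans (sym (∧-identityʳ c)) c∧1 , trans (sym (∧-identityʳ d)) d∧1
clearedBeforeBlocks {suc (suc (suc (suc k)))} c d _ (c∧1 , d∧1 , _) =
  trans (sym (∧-identityʳ c)) c∧1 , trans (sym (∧-identityʳ d)) d∧1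

fullBlock : ∀ {k} a b (S : Subset k) → 2 + ∣ S ∣ ≤ ∣ a ∷ b ∷ outside ∷ outside ∷ S ∣ →
            (a ≡ inside) × (b ≡ inside)
fullBlock inside inside S _ = refl , refl
fullBlock inside outside S (s≤s tooBig) = ⊥-elim (1+n≰n tooBig)
fullBlock outside inside S (s≤s tooBig) = ⊥-elim (1+n≰n tooBig)
fullBlock outside outside S tooBig = ⊥-elim (1+n≰n (≤-trans (n≤1+n _) tooBig))

uniqueAttainer : ∀ n → n % 4 ≡ 2 → (S : Subset n) → NoDistanceTwo S →
                 packingNumber n ≤ ∣ S ∣ → S ≡ blocks n
uniqueAttainer 0 () _ _ _
uniqueAttainer 1 () _ _ _
uniqueAttainer 3 () _ _ _
uniqueAttainer 2 _ S _ full = ∣p∣≡n⇒p≡⊤ (≤-antisym (∣p∣≤n S) full)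
uniqueAttainer (suc (suc (suc (suc k)))) k≡2 (a ∷ b ∷ c ∷ d ∷ S) ok@(a∧c , b∧d , _) full
  with refl ← uniqueAttainer k k≡2 S (noDistanceTwo-afterBlock a b c d S ok)
                (+-cancelˡ-≤ 2 _ _ (≤-trans full (blockBound a b c d S a∧c b∧d)))
  with refl , refl ← clearedBeforeBlocks c d k≡2
                       (noDistanceTwo-tail b _ (noDistanceTwo-tail a _ ok))
  with refl , refl ← fullBlock a b (blocks k)
                       (subst (_≤ ∣ a ∷ b ∷ c ∷ d ∷ blocks k ∣) (cong (2 +_) (sym (∣blocks∣ k))) full)
  = refl

mainTheorem18 : (n : ℕ) → 2 ≤ n → (HasUniqueMaxOpenPacking n ⇔ (n % 4 ≡ 2))
mainTheorem18 n 2≤n = mk⇔ unique⇒residue2 residue2⇒unique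
  where
  -- Otherwise blocks n and shiftedBlocks n are two different maximum packings.
  unique⇒residue2 : HasUniqueMaxOpenPacking n → n % 4 ≡ 2
  unique⇒residue2 (_ , _ , onlyOne) with n % 4 ≟ 2
  ... | yes n≡2 = n≡2
  ... | no n≢2 = ⊥-elim (shiftedBlocks≢blocks n 2≤n n≢2
    (trans (onlyOne _ (shiftedBlocks-maximum n)) (sym (onlyOne _ (blocks-maximum n)))))

  residue2⇒unique : n % 4 ≡ 2 → HasUniqueMaxOpenPacking n
  residue2⇒unique n≡2 = blocks n , blocks-maximum n , λ T maxT@(packing , _) →
    uniqueAttainer n n≡2 T (openPacking⇒noDistanceTwo T packing) (maximum⇒attainsBound T maxT)
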